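{- Let $\mathcal{H}=(V,E)$ be a hypergraph with $V=\{v_1,\dots,v_n\}$ and $k_{\max}=\max_{e\in E}|e|$, and let $\mathcal{A}_{\mathcal{H}}=(r_{i_1\dots i_{k_{\max}}})$ be its layered e-adjacency tensor. For $1\leqslant i\leqslant k_{\max}-1$ set $d_{n+i}=\sum_{i_2,\dots,i_{k_{\max}}=1}^{n+k_{\max}-1} r_{n+i\,i_2\dots i_{k_{\max}}}$, and set $d_{n+k_{\max}}=|E|$. Then $d_{n+i}=|\{e\in E:|e|\leqslant i\}|$ for $1\leqslant i\leqslant k_{\max}-1$; consequently $|\{e\in E:|e|=1\}|=d_{n+1}$ and $|\{e\in E:|e|=j\}|=d_{n+j}-d_{n+j-1}$ for $2\leqslant j\leqslant k_{\max}$.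
   Context: A hypergraph $\mathcal{H}=(V,E)$ has a finite vertex set $V=\{v_1,\dots,v_n\}$ and a nonempty set $E$ of nonempty subsets of $V$. The layered e-adjacency tensor $\mathcal{A}_{\mathcal{H}}$ is the real tensor of order $k_{\max}$ and dimension $n+k_{\max}-1$ (indices range over $\{1,\dots,n+k_{\max}-1\}$; index $n+j$ corresponds to an additional vertex $y_j$, $1\leqslant j\leqslant k_{\max}-1$) defined as follows: for each hyperedge $e=\{v_{i_1},\dots,v_{i_s}\}\in E$ with $s=|e|$, every entry whose index tuple is a permutation of the $k_{\max}$-tuple $(i_1,\dots,i_s,n+s,n+s+1,\dots,n+k_{\max}-1)$ equals $\frac{1}{(k_{\max}-1)!}$; all other entries are $0$. -}

module Defs where

open import Data.Nat as ℕ using (ℕ; zero; suc; _+_; _∸_; _≤_; _≤?_; _<?_; _≟_; _!)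
open import Data.Nat.Properties using (_!≢0)
open import Data.Integer using (+_)
open import Data.Rational using (ℚ; _/_; 0ℚ; _-_)
import Data.Rational as ℚ
open import Data.Fin using (Fin; toℕ; _↑ˡ_; _↑ʳ_; fromℕ<)
open import Data.Fin.Subset using (Subset; ∣_∣; Nonempty)
open import Data.Fin.Subset.Properties using (_∈?_)
open import Data.List using (List; []; _∷_; _++_; map; filter; length; allFin; foldr)
open import Data.List.Membership.Propositional using (_∈_)
open import Data.List.Relation.Unary.All using (All)
open import Data.List.Relation.Unary.Unique.Propositional using (Unique)
open import Data.List.Relation.Binary.Permutation.Propositional using (_↭_)
open import Data.Vec.Functional as VF using (Vector)
open import Data.Product using (Σ; ∃; _×_; _,_)
open import Relation.Binary.PropositionalEquality using (_≡_; _≢_)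
open import Relation.Nullary using (¬_; yes; no)
open import Relation.Unary using (Pred)

-- A hypergraph on vertex set V = Fin n: a finite set E of nonempty subsets of V,
-- represented as a duplicate-free, nonempty list of nonempty subsets.
record Hypergraph (n : ℕ) : Set where
  field
    edges    : List (Subset n)
    unique   : Unique edges
    nonemptyE : edges ≢ []
    nonemptyEdges : All Nonempty edges
open Hypergraph public

kmax : ∀ {n} → Hypergraph n → ℕ
kmax H = foldr (λ e m → ℕ._⊔_ ∣ e ∣ m) 0 (edges H)

countEdges : ∀ {n} → Hypergraph n → (P : ℕ → Set) → ((s : ℕ) → Relation.Nullary.Dec (P s)) → ℕ
countEdges H P P? = length (filter (λ e → P? ∣ e ∣) (edges H))

ℕtoℚ : ℕ → ℚ
ℕtoℚ m = + m / 1

-- Indices (0-based) of the tensor of order k_max = suc k and dimension n + k: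
-- vertex v_i ↦ inject+ k i,  additional vertex y_{j+1} (j : Fin k) ↦ raise n j.
vIdx : ∀ {n} k → Fin n → Fin (n + k)
vIdx k v = v ↑ˡ k

yIdx : ∀ n {k} → Fin k → Fin (n + k)
yIdx n j = n ↑ʳ j

-- The k_max-tuple (i_1,…,i_s, n+s, …, n+k_max-1) of a hyperedge e with s = |e|
-- (1-based y-indices s,…,k_max-1, i.e. 0-based j with s ∸ 1 ≤ j).
edgeTuple : ∀ {n} k → Subset n → List (Fin (n + k))
edgeTuple {n} k e =
  map (vIdx k) (filter (λ v → v ∈? e) (allFin n))
  ++ map (yIdx n) (filter (λ j → ∣ e ∣ ∸ 1 ≤? toℕ j) (allFin k))

Tensor : ℕ → ℕ → Set
Tensor ord N = (Fin ord → Fin N) → ℚ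

IsLayeredEAdjacency : ∀ {n} (H : Hypergraph n) (k : ℕ) → Tensor (suc k) (n + k) → Set
IsLayeredEAdjacency {n} H k A =
  (∀ t → (∃ λ e → e ∈ edges H × VF.toList t ↭ edgeTuple k e) →
         A t ≡ _/_ (+ 1) (k !) {{k !≢0}})
  × (∀ t → ¬ (∃ λ e → e ∈ edges H × VF.toList t ↭ edgeTuple k e) → A t ≡ 0ℚ)

sumFin : (N : ℕ) → (Fin N → ℚ) → ℚ
sumFin N f = foldr ℚ._+_ 0ℚ (map f (allFin N))

sumTuples : (m N : ℕ) → (Vector (Fin N) m → ℚ) → ℚ
sumTuples zero    N f = f (λ ())
sumTuples (suc m) N f = sumFin N (λ i → sumTuples m N (λ t → f (i VF.∷ t)))

-- d_{n+i} for 1 ≤ i ≤ k_max - 1 = k (argument j : Fin k is 0-based, i = toℕ j + 1):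
-- the sum of all entries r_{n+i, i_2, …, i_{k_max}}.
dY : ∀ {n} k → Tensor (suc k) (n + k) → Fin k → ℚ
dY {n} k A j = sumTuples k (n + k) (λ t → A (yIdx n j VF.∷ t))

-- d_{n+i} indexed by the 1-based i: tensor sum for 1 ≤ i ≤ k, and |E| for i = k + 1 = k_max.
d : ∀ {n} (H : Hypergraph n) k → Tensor (suc k) (n + k) → ℕ → ℚ
d H k A i with i ∸ 1 <? k
... | yes p = dY k A (fromℕ< p)
... | no _  = ℕtoℚ (length (edges H))

module Submission where

open import Defs
open import Data.Nat as ℕ
  using (ℕ; zero; suc; _+_; _*_; _∸_; _!; _≤_; _<_; _≤?_; _<?_; _≟_; _⊔_; z≤n; s≤s)
import Data.Nat.Properties as ℕP
open import Data.Nat.Properties using (_!≢0)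
open import Data.Integer as ℤ using (+_)
import Data.Integer.Properties as ℤP
open import Data.Rational as ℚ using (ℚ; _/_; 0ℚ; _-_)
import Data.Rational.Properties as ℚP
import Data.Rational.Unnormalised as ℚᵘ
import Data.Rational.Unnormalised.Properties as ℚᵘP
open import Data.Fin as F using (Fin; toℕ; fromℕ<)
import Data.Fin.Properties as FP
open import Data.Fin.Subset as S using (Subset; ∣_∣; inside; outside; Nonempty)
open import Data.Fin.Subset.Properties using (_∈?_; drop-there; x∈p⇒∣p-x∣<∣p∣; ⊆-antisym)
import Data.Vec.Base as Vec
open import Data.Vec.Functional as VF using (Vector)
open import Data.List using (List; []; _∷_; _++_; map; filter; length; lookup; tabulate; allFin; foldr)
import Data.List.Properties as LP
open import Data.List.Membership.Propositional using (_∈_; find; lose)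
open import Data.List.Membership.Propositional.Properties
  using (∈-lookup; ∈-∃++; ∈-map⁺; ∈-map⁻; ∈-filter⁺; ∈-filter⁻; ∈-++⁺ˡ; ∈-++⁺ʳ; ∈-++⁻; ∈-allFin)
open import Data.List.Relation.Unary.Any as Any using (Any; here; there; any?)
open import Data.List.Relation.Unary.All as All using (All)
open import Data.List.Relation.Unary.AllPairs using (_∷_)
open import Data.List.Relation.Unary.Unique.Propositional using (Unique)
import Data.List.Relation.Unary.Unique.Propositional.Properties as Unique
open import Data.List.Relation.Binary.Permutation.Propositional as ↭
  using (_↭_; prep; ↭-sym; ↭-trans; ↭⇒↭ₛ)
open import Data.List.Relation.Binary.Permutation.Propositional.Properties
  using (∈-resp-↭; ↭-length; shift; drop-mid)
import Data.List.Relation.Binary.Permutation.Setoid.Properties as ↭ₛ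
open import Data.Product using (_×_; _,_; proj₁; proj₂)
open import Data.Sum using (_⊎_; inj₁; inj₂; [_,_]′)
open import Data.Empty using (⊥; ⊥-elim)
open import Function.Bundles using (_⇔_; Equivalence; mk⇔)
open import Function.Definitions using (Injective)
open import Relation.Nullary using (¬_; Dec; yes; no)
open import Relation.Unary using (Pred; Decidable)
open import Relation.Binary.PropositionalEquality
open import Algebra.Properties.Group ℚP.+-0-group using (x≈z//y)
open import Algebra.Properties.Semiring.Sum ℕP.+-*-semiring
  using (sum-syntax; sum-cong-≗; sum-replicate-zero; ∑-distrib-+; ∑-comm; *-distribʳ-sum)

-- An entry A(t) is 1/k! (k = k_max - 1) exactly when t is a rearrangement of the
-- tuple T(e) = (vertices of e, y_|e|, …, y_k) of some hyperedge e, and 0 otherwise.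
-- Distinct hyperedges have tuples that are not rearrangements of each other, so
-- A(t) = (number of e with t ↭ T(e)) · 1/k!.  Summing over the row of y_j and
-- exchanging the sums, each hyperedge e contributes the number of rearrangements
-- of T(e) that start with y_j; as T(e) is duplicate-free of length k + 1, this
-- is k! when y_j occurs in T(e), i.e. when |e| ≤ j, and 0 otherwise.

𝟙 : ∀ {p} {P : Set p} → Dec P → ℕ
𝟙 (yes _) = 1
𝟙 (no _)  = 0

𝟙-yes : ∀ {p} {P : Set p} (P? : Dec P) → P → 𝟙 P? ≡ 1
𝟙-yes (yes _) _ = refl
𝟙-yes (no ¬p) p = ⊥-elim (¬p p)

𝟙-no : ∀ {p} {P : Set p} (P? : Dec P) → ¬ P → 𝟙 P? ≡ 0
𝟙-no (yes p) ¬p = ⊥-elim (¬p p)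
𝟙-no (no _)  _  = refl

𝟙-cong : ∀ {p q} {P : Set p} {Q : Set q} (P? : Dec P) (Q? : Dec Q) → P ⇔ Q → 𝟙 P? ≡ 𝟙 Q?
𝟙-cong (yes p) Q? P⇔Q = sym (𝟙-yes Q? (Equivalence.to P⇔Q p))
𝟙-cong (no ¬p) Q? P⇔Q = sym (𝟙-no Q? (λ q → ¬p (Equivalence.from P⇔Q q)))

𝟙-⊎ : ∀ {p q r} {P : Set p} {Q : Set q} {R : Set r} (P? : Dec P) (Q? : Dec Q) (R? : Dec R) →
      P ⇔ (Q ⊎ R) → ¬ (Q × R) → 𝟙 P? ≡ 𝟙 Q? + 𝟙 R?
𝟙-⊎ P? (yes q) R? P⇔Q⊎R disjoint = begin
  𝟙 P?       ≡⟨ 𝟙-yes P? (Equivalence.from P⇔Q⊎R (inj₁ q)) ⟩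
  1          ≡⟨ cong suc (𝟙-no R? (λ r → disjoint (q , r))) ⟨
  1 + 𝟙 R?   ∎
  where open ≡-Reasoning
𝟙-⊎ P? (no ¬q) R? P⇔Q⊎R _ = 𝟙-cong P? R? (mk⇔
  (λ p → [ (λ q → ⊥-elim (¬q q)) , (λ r → r) ]′ (Equivalence.to P⇔Q⊎R p))
  (λ r → Equivalence.from P⇔Q⊎R (inj₂ r)))

∑-zero : ∀ {N} {f : Fin N → ℕ} → (∀ i → f i ≡ 0) → ∑[ i < N ] f i ≡ 0
∑-zero {N} f≡0 = trans (sum-cong-≗ f≡0) (sum-replicate-zero N)

∑-delta : ∀ {N} (x : Fin N) → ∑[ i < N ] 𝟙 (i F.≟ x) ≡ 1
∑-delta {suc N} F.zero = cong suc (∑-zero {N} (λ i → 𝟙-no (F.suc i F.≟ F.zero) λ ()))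
∑-delta {suc N} (F.suc x) = trans
  (sum-cong-≗ (λ i → 𝟙-cong (F.suc i F.≟ F.suc x) (i F.≟ x) (mk⇔ FP.suc-injective (cong F.suc))))
  (∑-delta x)

∑ˡ : ∀ {a} {A : Set a} → List A → (A → ℕ) → ℕ
∑ˡ xs f = ∑[ i < length xs ] f (lookup xs i)

∑ˡ-cong : ∀ {a} {A : Set a} (xs : List A) {f g : A → ℕ} → (∀ {x} → x ∈ xs → f x ≡ g x) → ∑ˡ xs f ≡ ∑ˡ xs g
∑ˡ-cong xs f≡g = sum-cong-≗ (λ i → f≡g (∈-lookup i))

∑ˡ-distrib-+ : ∀ {a} {A : Set a} (xs : List A) (f g : A → ℕ) → ∑ˡ xs (λ x → f x + g x) ≡ ∑ˡ xs f + ∑ˡ xs g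
∑ˡ-distrib-+ xs f g = ∑-distrib-+ (λ i → f (lookup xs i)) (λ i → g (lookup xs i))

∑ˡ-*-distribʳ : ∀ {a} {A : Set a} (xs : List A) (f : A → ℕ) c → ∑ˡ xs f * c ≡ ∑ˡ xs (λ x → f x * c)
∑ˡ-*-distribʳ xs f c = *-distribʳ-sum c (λ i → f (lookup xs i))

length-filter : ∀ {a p} {A : Set a} {P : Pred A p} (P? : Decidable P) (xs : List A) →
                length (filter P? xs) ≡ ∑ˡ xs (λ x → 𝟙 (P? x))
length-filter P? [] = refl
length-filter P? (x ∷ xs) with P? x
... | yes _ = cong suc (length-filter P? xs)
... | no _  = length-filter P? xs

length-filter-tabulate : ∀ {a p} {A : Set a} {P : Pred A p} (P? : Decidable P) N (f : Fin N → A) →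
                         length (filter P? (tabulate f)) ≡ ∑[ i < N ] 𝟙 (P? (f i))
length-filter-tabulate P? zero f = refl
length-filter-tabulate P? (suc N) f with P? (f F.zero)
... | yes _ = cong suc (length-filter-tabulate P? N (λ i → f (F.suc i)))
... | no _  = length-filter-tabulate P? N (λ i → f (F.suc i))

∑ˡ-atMostOne : ∀ {a p} {A : Set a} {P : Pred A p} (P? : Decidable P) {xs : List A} → Unique xs →
               (∀ {x y} → P x → P y → x ≡ y) → ∑ˡ xs (λ x → 𝟙 (P? x)) ≡ 𝟙 (any? P? xs)
∑ˡ-atMostOne P? {[]} _ _ = refl
∑ˡ-atMostOne {P = P} P? {x ∷ xs} (x∉xs ∷ unique) atMostOne with P? x
... | yes px = begin
  1 + ∑ˡ xs (λ x → 𝟙 (P? x)) ≡⟨ cong suc (∑ˡ-atMostOne P? unique atMostOne) ⟩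
  1 + 𝟙 (any? P? xs)          ≡⟨ cong suc (𝟙-no (any? P? xs) noOther) ⟩
  1                           ∎
  where
  open ≡-Reasoning
  noOther : ¬ Any P xs
  noOther any with find any
  ... | _ , y∈xs , py = All.lookup x∉xs y∈xs (atMostOne px py)
... | no ¬px = trans (∑ˡ-atMostOne P? unique atMostOne)
  (𝟙-cong (any? P? xs) _ (mk⇔ there λ { (here px) → ⊥-elim (¬px px) ; (there a) → a }))

∑ᵀ : (m N : ℕ) → (Vector (Fin N) m → ℕ) → ℕ
∑ᵀ zero    N f = f (λ ())
∑ᵀ (suc m) N f = ∑[ i < N ] ∑ᵀ m N (λ t → f (i VF.∷ t))

∑ᵀ-cong : ∀ m N {f g : Vector (Fin N) m → ℕ} → (∀ t → f t ≡ g t) → ∑ᵀ m N f ≡ ∑ᵀ m N g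
∑ᵀ-cong zero    N f≡g = f≡g _
∑ᵀ-cong (suc m) N f≡g = sum-cong-≗ {N} (λ i → ∑ᵀ-cong m N (λ t → f≡g _))

∑ᵀ-zero : ∀ m N {f : Vector (Fin N) m → ℕ} → (∀ t → f t ≡ 0) → ∑ᵀ m N f ≡ 0
∑ᵀ-zero zero    N f≡0 = f≡0 _
∑ᵀ-zero (suc m) N f≡0 = ∑-zero {N} (λ i → ∑ᵀ-zero m N (λ t → f≡0 _))

∑ᵀ-∑ˡ-comm : ∀ {a} {A : Set a} m N (xs : List A) (g : Vector (Fin N) m → A → ℕ) →
             ∑ᵀ m N (λ t → ∑ˡ xs (g t)) ≡ ∑ˡ xs (λ x → ∑ᵀ m N (λ t → g t x))
∑ᵀ-∑ˡ-comm zero    N xs g = refl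
∑ᵀ-∑ˡ-comm (suc m) N xs g = trans
  (sum-cong-≗ {N} (λ i → ∑ᵀ-∑ˡ-comm m N xs (λ t → g (i VF.∷ t))))
  (∑-comm (λ i j → ∑ᵀ m N (λ t → g (i VF.∷ t) (lookup xs j))))

∷-↭-cancel : ∀ {a} {A : Set a} (x : A) {xs} ws zs → (x ∷ xs ↭ ws ++ x ∷ zs) ⇔ (xs ↭ ws ++ zs)
∷-↭-cancel x ws zs = mk⇔ (drop-mid [] ws) (λ p → ↭.trans (prep x p) (↭-sym (shift x ws zs)))

unique-remove : ∀ {a} {A : Set a} {x : A} ws zs → Unique (ws ++ x ∷ zs) → Unique (ws ++ zs)
unique-remove {A = A} {x} ws zs u with _ ∷ u′ ← ↭ₛ.Unique-resp-↭ (setoid A) (↭⇒↭ₛ (shift x ws zs)) u = u′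

length-remove : ∀ {a} {A : Set a} {x : A} ws zs → length (ws ++ x ∷ zs) ≡ suc (length (ws ++ zs))
length-remove {x = x} ws zs = ↭-length (shift x ws zs)

module _ {N : ℕ} where
  open import Data.List.Membership.DecPropositional (F._≟_ {N}) using () renaming (_∈?_ to _∈ˡ?_)

  _↭?_ : (xs ys : List (Fin N)) → Dec (xs ↭ ys)
  [] ↭? [] = yes ↭.refl
  [] ↭? (y ∷ ys) = no (λ p → ℕP.0≢1+n (↭-length p))
  (x ∷ xs) ↭? ys with x ∈ˡ? ys
  ... | no x∉ys = no (λ p → x∉ys (∈-resp-↭ p (here refl)))
  ... | yes x∈ys with ∈-∃++ x∈ys
  ...   | ws , zs , refl with xs ↭? (ws ++ zs)
  ...     | yes p = yes (Equivalence.from (∷-↭-cancel x ws zs) p)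
  ...     | no ¬p = no (λ p → ¬p (Equivalence.to (∷-↭-cancel x ws zs) p))

  ∑-membership : ∀ {L : List (Fin N)} → Unique L → ∑[ i < N ] 𝟙 (i ∈ˡ? L) ≡ length L
  ∑-membership {[]} _ = ∑-zero (λ i → 𝟙-no (i ∈ˡ? []) λ ())
  ∑-membership {x ∷ L} (x∉L ∷ unique) = begin
    ∑[ i < N ] 𝟙 (i ∈ˡ? (x ∷ L))                  ≡⟨ sum-cong-≗ {N} splitMembership ⟩
    ∑[ i < N ] (𝟙 (i F.≟ x) + 𝟙 (i ∈ˡ? L))        ≡⟨ ∑-distrib-+ (λ i → 𝟙 (i F.≟ x)) (λ i → 𝟙 (i ∈ˡ? L)) ⟩
    ∑[ i < N ] 𝟙 (i F.≟ x) + ∑[ i < N ] 𝟙 (i ∈ˡ? L) ≡⟨ cong₂ _+_ (∑-delta x) (∑-membership unique) ⟩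
    suc (length L)                               ∎
    where
    open ≡-Reasoning
    splitMembership : ∀ i → 𝟙 (i ∈ˡ? (x ∷ L)) ≡ 𝟙 (i F.≟ x) + 𝟙 (i ∈ˡ? L)
    splitMembership i = 𝟙-⊎ (i ∈ˡ? (x ∷ L)) (i F.≟ x) (i ∈ˡ? L) (mk⇔ Any.toSum Any.fromSum)
      (λ { (refl , i∈L) → All.lookup x∉L i∈L refl })

  mutual
    arrangements : ∀ m {L : List (Fin N)} → Unique L → length L ≡ m →
                   ∑ᵀ m N (λ t → 𝟙 (VF.toList t ↭? L)) ≡ m !
    arrangements zero {[]} _ _ = refl
    arrangements (suc m) {L} unique len = begin
      ∑[ i < N ] ∑ᵀ m N (λ t → 𝟙 ((i ∷ VF.toList t) ↭? L)) ≡⟨ sum-cong-≗ {N} (λ i → arrangementsFrom m unique len i (i ∈ˡ? L)) ⟩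
      ∑[ i < N ] (𝟙 (i ∈ˡ? L) * m !)                      ≡⟨ *-distribʳ-sum (m !) (λ i → 𝟙 (i ∈ˡ? L)) ⟨
      ∑[ i < N ] 𝟙 (i ∈ˡ? L) * m !                         ≡⟨ cong (_* m !) (trans (∑-membership unique) len) ⟩
      suc m * m !                                         ∎
      where open ≡-Reasoning

    arrangementsFrom : ∀ m {L : List (Fin N)} → Unique L → length L ≡ suc m → ∀ i (i∈L? : Dec (i ∈ L)) →
                       ∑ᵀ m N (λ t → 𝟙 ((i ∷ VF.toList t) ↭? L)) ≡ 𝟙 i∈L? * m !
    arrangementsFrom m {L} unique len i (no i∉L) = ∑ᵀ-zero m N (λ t → 𝟙-no ((i ∷ VF.toList t) ↭? L) (λ p → i∉L (∈-resp-↭ p (here refl))))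
    arrangementsFrom m {L} unique len i (yes i∈L) with ws , zs , refl ← ∈-∃++ i∈L = begin
      ∑ᵀ m N (λ t → 𝟙 ((i ∷ VF.toList t) ↭? (ws ++ i ∷ zs)))
        ≡⟨ ∑ᵀ-cong m N (λ t → 𝟙-cong ((i ∷ VF.toList t) ↭? _) (VF.toList t ↭? _) (∷-↭-cancel i ws zs)) ⟩
      ∑ᵀ m N (λ t → 𝟙 (VF.toList t ↭? (ws ++ zs)))
        ≡⟨ arrangements m (unique-remove ws zs unique) (ℕP.suc-injective (trans (sym (length-remove ws zs)) len)) ⟩
      m !                                                 ≡⟨ ℕP.+-identityʳ (m !) ⟨
      1 * m !                                             ∎
      where open ≡-Reasoning

∈-filter-allFin⇔ : ∀ {N p} {P : Pred (Fin N) p} (P? : Decidable P) {x} → x ∈ filter P? (allFin N) ⇔ P x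
∈-filter-allFin⇔ {N} P? = mk⇔ (λ x∈ → proj₂ (∈-filter⁻ P? {xs = allFin N} x∈)) (∈-filter⁺ P? (∈-allFin _))

∈-map-injective⇔ : ∀ {a b} {A : Set a} {B : Set b} {f : A → B} → Injective _≡_ _≡_ f →
                   ∀ {x xs} → f x ∈ map f xs ⇔ x ∈ xs
∈-map-injective⇔ {f = f} injective {xs = xs} = mk⇔ reflect (∈-map⁺ f)
  where
  reflect : ∀ {x} → f x ∈ map f xs → x ∈ xs
  reflect fx∈ with y , y∈xs , fx≡fy ← ∈-map⁻ f fx∈ = subst (_∈ xs) (sym (injective fx≡fy)) y∈xs

nonempty⇒size≥1 : ∀ {n} {e : Subset n} → Nonempty e → 1 ≤ ∣ e ∣
nonempty⇒size≥1 (_ , v∈e) = ℕP.≤-trans (s≤s z≤n) (x∈p⇒∣p-x∣<∣p∣ v∈e)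

size≤kmax : ∀ {n} (es : List (Subset n)) {e} → e ∈ es → ∣ e ∣ ≤ foldr (λ e m → ∣ e ∣ ⊔ m) 0 es
size≤kmax (e ∷ es) (here refl) = ℕP.m≤m⊔n ∣ e ∣ _
size≤kmax (e ∷ es) (there e∈es) = ℕP.≤-trans (size≤kmax es e∈es) (ℕP.m≤n⊔m ∣ e ∣ _)

𝟙-∈-suc : ∀ {n} x (e : Subset n) i → 𝟙 (i ∈? e) ≡ 𝟙 (F.suc i ∈? (x Vec.∷ e))
𝟙-∈-suc x e i = 𝟙-cong (i ∈? e) (F.suc i ∈? (x Vec.∷ e)) (mk⇔ Vec.there drop-there)

size≡∑ : ∀ {n} (e : Subset n) → ∣ e ∣ ≡ ∑[ i < n ] 𝟙 (i ∈? e)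
size≡∑ Vec.[] = refl
size≡∑ {suc n} (inside Vec.∷ e)  = cong suc (trans (size≡∑ e) (sum-cong-≗ {n} (𝟙-∈-suc inside e)))
size≡∑ {suc n} (outside Vec.∷ e) = trans (size≡∑ e) (sum-cong-≗ {n} (𝟙-∈-suc outside e))

∑-atLeast : ∀ k a → ∑[ j < k ] 𝟙 (a ≤? toℕ j) ≡ k ∸ a
∑-atLeast zero    a       = sym (ℕP.0∸n≡0 a)
∑-atLeast (suc k) zero    = cong suc (trans (sum-cong-≗ {k} reindex) (∑-atLeast k zero))
  where
  reindex : ∀ j → 𝟙 (0 ≤? suc (toℕ j)) ≡ 𝟙 (0 ≤? toℕ j)
  reindex j = 𝟙-cong (0 ≤? suc (toℕ j)) (0 ≤? toℕ j) (mk⇔ (λ _ → z≤n) (λ _ → z≤n))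
∑-atLeast (suc k) (suc a) = trans (sum-cong-≗ {k} reindex) (∑-atLeast k a)
  where
  reindex : ∀ j → 𝟙 (suc a ≤? suc (toℕ j)) ≡ 𝟙 (a ≤? toℕ j)
  reindex j = 𝟙-cong (suc a ≤? suc (toℕ j)) (a ≤? toℕ j) (mk⇔ ℕP.≤-pred s≤s)

∸1≤⇔≤suc : ∀ s j → s ∸ 1 ≤ j ⇔ s ≤ suc j
∸1≤⇔≤suc zero    j = mk⇔ (λ _ → z≤n) (λ _ → z≤n)
∸1≤⇔≤suc (suc s) j = mk⇔ s≤s ℕP.≤-pred

module _ {n : ℕ} (k : ℕ) where

  vertexBlock : Subset n → List (Fin n)
  vertexBlock e = filter (λ v → v ∈? e) (allFin n)

  layerBlock : Subset n → List (Fin k)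
  layerBlock e = filter (λ j → ∣ e ∣ ∸ 1 ≤? toℕ j) (allFin k)

  vIdx-injective : Injective _≡_ _≡_ (vIdx {n} k)
  vIdx-injective = FP.↑ˡ-injective k _ _

  yIdx-injective : Injective _≡_ _≡_ (yIdx n {k})
  yIdx-injective = FP.↑ʳ-injective n _ _

  vIdx≢yIdx : ∀ v j → vIdx k v ≢ yIdx n j
  vIdx≢yIdx v j eq = ℕP.<⇒≢ v<n+j (begin
    toℕ v            ≡⟨ FP.toℕ-↑ˡ v k ⟨
    toℕ (vIdx k v)   ≡⟨ cong toℕ eq ⟩
    toℕ (yIdx n j)   ≡⟨ FP.toℕ-↑ʳ n j ⟩
    n + toℕ j        ∎)
    where
    open ≡-Reasoning
    v<n+j : toℕ v < n + toℕ j
    v<n+j = ℕP.≤-trans (FP.toℕ<n v) (ℕP.m≤m+n n (toℕ j))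

  edgeTuple-length : ∀ e → 1 ≤ ∣ e ∣ → ∣ e ∣ ≤ suc k → length (edgeTuple k e) ≡ suc k
  edgeTuple-length e 1≤∣e∣ ∣e∣≤k+1 = begin
    length (edgeTuple k e)
      ≡⟨ LP.length-++ (map (vIdx k) (vertexBlock e)) ⟩
    length (map (vIdx k) (vertexBlock e)) + length (map (yIdx n) (layerBlock e))
      ≡⟨ cong₂ _+_ (LP.length-map (vIdx k) (vertexBlock e)) (LP.length-map (yIdx n) (layerBlock e)) ⟩
    length (vertexBlock e) + length (layerBlock e)
      ≡⟨ cong₂ _+_ (length-filter-tabulate _ n (λ v → v)) (length-filter-tabulate _ k (λ j → j)) ⟩
    ∑[ v < n ] 𝟙 (v ∈? e) + ∑[ j < k ] 𝟙 (∣ e ∣ ∸ 1 ≤? toℕ j)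
      ≡⟨ cong₂ _+_ (sym (size≡∑ e)) (∑-atLeast k (∣ e ∣ ∸ 1)) ⟩
    ∣ e ∣ + (k ∸ (∣ e ∣ ∸ 1))
      ≡⟨ fill ∣ e ∣ 1≤∣e∣ ∣e∣≤k+1 ⟩
    suc k ∎
    where
    open ≡-Reasoning
    fill : ∀ s → 1 ≤ s → s ≤ suc k → s + (k ∸ (s ∸ 1)) ≡ suc k
    fill (suc s) _ (s≤s s≤k) = cong suc (ℕP.m+[n∸m]≡n s≤k)

  edgeTuple-unique : ∀ e → Unique (edgeTuple k e)
  edgeTuple-unique e = Unique.++⁺
    (Unique.map⁺ vIdx-injective (Unique.filter⁺ (λ v → v ∈? e) (Unique.allFin⁺ n)))
    (Unique.map⁺ yIdx-injective (Unique.filter⁺ (λ j → ∣ e ∣ ∸ 1 ≤? toℕ j) (Unique.allFin⁺ k)))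
    λ (w∈vertices , w∈layers) → disjoint w∈vertices w∈layers
    where
    disjoint : ∀ {w} → w ∈ map (vIdx k) (vertexBlock e) → w ∈ map (yIdx n) (layerBlock e) → ⊥
    disjoint p q with v , _ , refl ← ∈-map⁻ (vIdx k) p | j , _ , eq ← ∈-map⁻ (yIdx n) q = vIdx≢yIdx v j eq

  vIdx∈edgeTuple⇔ : ∀ {e} v → vIdx k v ∈ edgeTuple k e ⇔ v S.∈ e
  vIdx∈edgeTuple⇔ {e} v = mk⇔ to from
    where
    to : vIdx k v ∈ edgeTuple k e → v S.∈ e
    to p with ∈-++⁻ (map (vIdx k) (vertexBlock e)) p
    ... | inj₁ q = Equivalence.to (∈-filter-allFin⇔ (λ v → v ∈? e))
                     (Equivalence.to (∈-map-injective⇔ vIdx-injective) q)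
    ... | inj₂ q with j , _ , eq ← ∈-map⁻ (yIdx n) q = ⊥-elim (vIdx≢yIdx v j eq)
    from : v S.∈ e → vIdx k v ∈ edgeTuple k e
    from v∈e = ∈-++⁺ˡ (∈-map⁺ (vIdx k) (Equivalence.from (∈-filter-allFin⇔ (λ v → v ∈? e)) v∈e))

  yIdx∈edgeTuple⇔ : ∀ {e} j → yIdx n j ∈ edgeTuple k e ⇔ ∣ e ∣ ≤ suc (toℕ j)
  yIdx∈edgeTuple⇔ {e} j = mk⇔ to from
    where
    to : yIdx n j ∈ edgeTuple k e → ∣ e ∣ ≤ suc (toℕ j)
    to p with ∈-++⁻ (map (vIdx k) (vertexBlock e)) p
    ... | inj₁ q with v , _ , eq ← ∈-map⁻ (vIdx k) q = ⊥-elim (vIdx≢yIdx v j (sym eq))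
    ... | inj₂ q = Equivalence.to (∸1≤⇔≤suc ∣ e ∣ (toℕ j))
                     (Equivalence.to (∈-filter-allFin⇔ (λ j → ∣ e ∣ ∸ 1 ≤? toℕ j))
                       (Equivalence.to (∈-map-injective⇔ yIdx-injective) q))
    from : ∣ e ∣ ≤ suc (toℕ j) → yIdx n j ∈ edgeTuple k e
    from le = ∈-++⁺ʳ (map (vIdx k) (vertexBlock e)) (∈-map⁺ (yIdx n)
      (Equivalence.from (∈-filter-allFin⇔ (λ j → ∣ e ∣ ∸ 1 ≤? toℕ j)) (Equivalence.from (∸1≤⇔≤suc ∣ e ∣ (toℕ j)) le)))

  edgeTuple-injective : ∀ {e e′} → edgeTuple k e ↭ edgeTuple k e′ → e ≡ e′
  edgeTuple-injective {e} {e′} p = ⊆-antisym (transport p) (transport (↭-sym p))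
    where
    transport : ∀ {a b} → edgeTuple k a ↭ edgeTuple k b → a S.⊆ b
    transport {a} {b} q {v} v∈a = Equivalence.to (vIdx∈edgeTuple⇔ v)
      (∈-resp-↭ q (Equivalence.from (vIdx∈edgeTuple⇔ v) v∈a))

toℚᵘ-ℕtoℚ : ∀ m → ℚ.toℚᵘ (ℕtoℚ m) ℚᵘ.≃ ℚᵘ.mkℚᵘ (+ m) 0
toℚᵘ-ℕtoℚ m = ℚP.toℚᵘ-fromℚᵘ (ℚᵘ.mkℚᵘ (+ m) 0)

-- Cross-multiplied form of  (a + b)/1 = a/1 + b/1.
+-cross : ∀ a b → + (a + b) ℤ.* + 1 ≡ (+ a ℤ.* + 1 ℤ.+ + b ℤ.* + 1) ℤ.* + 1
+-cross a b = begin
  + (a + b) ℤ.* + 1                     ≡⟨ ℤP.*-identityʳ _ ⟩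
  + (a + b)                             ≡⟨ ℤP.pos-+ a b ⟩
  + a ℤ.+ + b                           ≡⟨ cong₂ ℤ._+_ (ℤP.*-identityʳ (+ a)) (ℤP.*-identityʳ (+ b)) ⟨
  + a ℤ.* + 1 ℤ.+ + b ℤ.* + 1           ≡⟨ ℤP.*-identityʳ _ ⟨
  (+ a ℤ.* + 1 ℤ.+ + b ℤ.* + 1) ℤ.* + 1 ∎
  where open ≡-Reasoning

-- Cross-multiplied form of  (c * d)/1 * 1/d = c/1.
*-cancel-cross : ∀ c d → (+ (c * d) ℤ.* + 1) ℤ.* + 1 ≡ + c ℤ.* + (1 * d)
*-cancel-cross c d = begin
  (+ (c * d) ℤ.* + 1) ℤ.* + 1 ≡⟨ ℤP.*-identityʳ _ ⟩
  + (c * d) ℤ.* + 1           ≡⟨ ℤP.*-identityʳ _ ⟩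
  + (c * d)                   ≡⟨ cong (λ x → + (c * x)) (ℕP.*-identityˡ d) ⟨
  + (c * (1 * d))             ≡⟨ ℤP.pos-* c (1 * d) ⟩
  + c ℤ.* + (1 * d)           ∎
  where open ≡-Reasoning

ℕtoℚ-+ : ∀ a b → ℕtoℚ (a + b) ≡ ℕtoℚ a ℚ.+ ℕtoℚ b
ℕtoℚ-+ a b = ℚP.toℚᵘ-injective (begin
  ℚ.toℚᵘ (ℕtoℚ (a + b))                 ≈⟨ toℚᵘ-ℕtoℚ (a + b) ⟩
  ℚᵘ.mkℚᵘ (+ (a + b)) 0                 ≈⟨ ℚᵘ.*≡* (+-cross a b) ⟩
  ℚᵘ.mkℚᵘ (+ a) 0 ℚᵘ.+ ℚᵘ.mkℚᵘ (+ b) 0 ≈⟨ ℚᵘP.+-cong (toℚᵘ-ℕtoℚ a) (toℚᵘ-ℕtoℚ b) ⟨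
  ℚ.toℚᵘ (ℕtoℚ a) ℚᵘ.+ ℚ.toℚᵘ (ℕtoℚ b) ≈⟨ ℚP.toℚᵘ-homo-+ (ℕtoℚ a) (ℕtoℚ b) ⟨
  ℚ.toℚᵘ (ℕtoℚ a ℚ.+ ℕtoℚ b)            ∎)
  where open ℚᵘP.≃-Reasoning

ℕtoℚ-*-cancel : ∀ c d .{{_ : ℕ.NonZero d}} → ℕtoℚ (c * d) ℚ.* (+ 1 / d) ≡ ℕtoℚ c
ℕtoℚ-*-cancel c d@(suc d-1) = ℚP.toℚᵘ-injective (begin
  ℚ.toℚᵘ (ℕtoℚ (c * d) ℚ.* (+ 1 / d))         ≈⟨ ℚP.toℚᵘ-homo-* (ℕtoℚ (c * d)) (+ 1 / d) ⟩
  ℚ.toℚᵘ (ℕtoℚ (c * d)) ℚᵘ.* ℚ.toℚᵘ (+ 1 / d) ≈⟨ ℚᵘP.*-cong (toℚᵘ-ℕtoℚ (c * d)) (ℚP.toℚᵘ-fromℚᵘ (ℚᵘ.mkℚᵘ (+ 1) d-1)) ⟩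
  ℚᵘ.mkℚᵘ (+ (c * d)) 0 ℚᵘ.* ℚᵘ.mkℚᵘ (+ 1) d-1 ≈⟨ ℚᵘ.*≡* (*-cancel-cross c d) ⟩
  ℚᵘ.mkℚᵘ (+ c) 0                             ≈⟨ toℚᵘ-ℕtoℚ c ⟨
  ℚ.toℚᵘ (ℕtoℚ c)                             ∎)
  where open ℚᵘP.≃-Reasoning

difference : ∀ {a b c} → a ℚ.+ b ≡ c → a ≡ c - b
difference {a} {b} {c} = x≈z//y a b c

sumFin-suc : ∀ N (g : Fin (suc N) → ℚ) → sumFin (suc N) g ≡ g F.zero ℚ.+ sumFin N (λ i → g (F.suc i))
sumFin-suc N g = cong (λ xs → g F.zero ℚ.+ foldr ℚ._+_ 0ℚ xs)
  (trans (LP.map-tabulate F.suc g) (sym (LP.map-tabulate (λ i → i) (λ i → g (F.suc i)))))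

sumFin-multiples : ∀ N (g : Fin N → ℚ) (f : Fin N → ℕ) q → (∀ i → g i ≡ ℕtoℚ (f i) ℚ.* q) →
                   sumFin N g ≡ ℕtoℚ (∑[ i < N ] f i) ℚ.* q
sumFin-multiples zero    g f q _ = sym (ℚP.*-zeroˡ q)
sumFin-multiples (suc N) g f q g≡fq = begin
  sumFin (suc N) g                                          ≡⟨ sumFin-suc N g ⟩
  g F.zero ℚ.+ sumFin N (λ i → g (F.suc i))                 ≡⟨ cong₂ ℚ._+_ (g≡fq F.zero) (sumFin-multiples N _ _ q (λ i → g≡fq (F.suc i))) ⟩
  ℕtoℚ (f F.zero) ℚ.* q ℚ.+ ℕtoℚ (∑[ i < N ] f (F.suc i)) ℚ.* q ≡⟨ ℚP.*-distribʳ-+ q (ℕtoℚ (f F.zero)) _ ⟨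
  (ℕtoℚ (f F.zero) ℚ.+ ℕtoℚ (∑[ i < N ] f (F.suc i))) ℚ.* q   ≡⟨ cong (ℚ._* q) (ℕtoℚ-+ (f F.zero) _) ⟨
  ℕtoℚ (∑[ i < suc N ] f i) ℚ.* q                             ∎
  where open ≡-Reasoning

sumTuples-multiples : ∀ m N (g : Vector (Fin N) m → ℚ) (f : Vector (Fin N) m → ℕ) q →
                      (∀ t → g t ≡ ℕtoℚ (f t) ℚ.* q) → sumTuples m N g ≡ ℕtoℚ (∑ᵀ m N f) ℚ.* q
sumTuples-multiples zero    N g f q g≡fq = g≡fq _
sumTuples-multiples (suc m) N g f q g≡fq =
  sumFin-multiples N _ _ q (λ i → sumTuples-multiples m N _ _ q (λ t → g≡fq _))

module _ {n} (H : Hypergraph n) where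

  #≤ : ℕ → ℕ
  #≤ i = countEdges H (λ s → s ≤ i) (λ s → s ≤? i)

  #≡ : ℕ → ℕ
  #≡ i = countEdges H (λ s → s ≡ i) (λ s → s ≟ i)

  edge-size≥1 : ∀ {e} → e ∈ edges H → 1 ≤ ∣ e ∣
  edge-size≥1 e∈E = nonempty⇒size≥1 (All.lookup (nonemptyEdges H) e∈E)

  #≤-suc : ∀ j → #≤ (suc j) ≡ #≡ (suc j) + #≤ j
  #≤-suc j = begin
    #≤ (suc j)                                               ≡⟨ length-filter (λ e → ∣ e ∣ ≤? suc j) (edges H) ⟩
    ∑ˡ (edges H) (λ e → 𝟙 (∣ e ∣ ≤? suc j))                  ≡⟨ ∑ˡ-cong (edges H) (λ {e} _ → split ∣ e ∣) ⟩
    ∑ˡ (edges H) (λ e → 𝟙 (∣ e ∣ ≟ suc j) + 𝟙 (∣ e ∣ ≤? j)) ≡⟨ ∑ˡ-distrib-+ (edges H) (λ e → 𝟙 (∣ e ∣ ≟ suc j)) (λ e → 𝟙 (∣ e ∣ ≤? j)) ⟩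
    ∑ˡ (edges H) (λ e → 𝟙 (∣ e ∣ ≟ suc j)) + ∑ˡ (edges H) (λ e → 𝟙 (∣ e ∣ ≤? j))
      ≡⟨ cong₂ _+_ (length-filter (λ e → ∣ e ∣ ≟ suc j) (edges H)) (length-filter (λ e → ∣ e ∣ ≤? j) (edges H)) ⟨
    #≡ (suc j) + #≤ j                                        ∎
    where
    open ≡-Reasoning
    split : ∀ s → 𝟙 (s ≤? suc j) ≡ 𝟙 (s ≟ suc j) + 𝟙 (s ≤? j)
    split s = 𝟙-⊎ (s ≤? suc j) (s ≟ suc j) (s ≤? j) (mk⇔
      (λ s≤j+1 → [ (λ s<j+1 → inj₂ (ℕP.≤-pred s<j+1)) , inj₁ ]′ (ℕP.m≤n⇒m<n∨m≡n s≤j+1))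
      [ ℕP.≤-reflexive , ℕP.m≤n⇒m≤1+n ]′)
      (λ { (refl , j+1≤j) → ℕP.<-irrefl refl j+1≤j })

  -- Hyperedges are nonempty, so having at most one vertex means having exactly one.
  #≡1 : #≡ 1 ≡ #≤ 1
  #≡1 = begin
    #≡ 1                              ≡⟨ length-filter (λ e → ∣ e ∣ ≟ 1) (edges H) ⟩
    ∑ˡ (edges H) (λ e → 𝟙 (∣ e ∣ ≟ 1)) ≡⟨ ∑ˡ-cong (edges H) (λ {e} e∈E → 𝟙-cong (∣ e ∣ ≟ 1) (∣ e ∣ ≤? 1)
                                          (mk⇔ ℕP.≤-reflexive (λ ∣e∣≤1 → ℕP.≤-antisym ∣e∣≤1 (edge-size≥1 e∈E)))) ⟩
    ∑ˡ (edges H) (λ e → 𝟙 (∣ e ∣ ≤? 1)) ≡⟨ length-filter (λ e → ∣ e ∣ ≤? 1) (edges H) ⟨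
    #≤ 1                              ∎
    where open ≡-Reasoning

  #≤-all : ∀ i → (∀ {e} → e ∈ edges H → ∣ e ∣ ≤ i) → #≤ i ≡ length (edges H)
  #≤-all i allSmall = cong length (LP.filter-all (λ e → ∣ e ∣ ≤? i) (All.tabulate allSmall))

module _ {n} (H : Hypergraph n) (k : ℕ) (kmax≡k+1 : kmax H ≡ suc k)
         (A : Tensor (suc k) (n + k)) (layered : IsLayeredEAdjacency H k A) where
  open import Data.List.Membership.DecPropositional (F._≟_ {n + k}) using () renaming (_∈?_ to _∈ˡ?_)

  q : ℚ
  q = _/_ (+ 1) (k !) {{k !≢0}}

  edge-size≤ : ∀ {e} → e ∈ edges H → ∣ e ∣ ≤ suc k
  edge-size≤ {e} e∈E = subst (∣ e ∣ ≤_) kmax≡k+1 (size≤kmax (edges H) e∈E)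

  occurrences : Vector (Fin (n + k)) (suc k) → ℕ
  occurrences t = ∑ˡ (edges H) (λ e → 𝟙 (VF.toList t ↭? edgeTuple k e))

  -- Each entry of the tensor is q times the number of hyperedges it stems from;
  -- this number is 0 or 1 because distinct hyperedges have non-rearrangeable tuples.
  entry : ∀ t → A t ≡ ℕtoℚ (occurrences t) ℚ.* q
  entry t = begin
    A t                          ≡⟨ entryByDecision (any? (λ e → VF.toList t ↭? edgeTuple k e) (edges H)) ⟩
    ℕtoℚ (𝟙 (any? (λ e → VF.toList t ↭? edgeTuple k e) (edges H))) ℚ.* q
      ≡⟨ cong (λ c → ℕtoℚ c ℚ.* q) (∑ˡ-atMostOne (λ e → VF.toList t ↭? edgeTuple k e) (unique H)
           (λ t↭e t↭e′ → edgeTuple-injective k (↭-trans (↭-sym t↭e) t↭e′))) ⟨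
    ℕtoℚ (occurrences t) ℚ.* q ∎
    where
    open ≡-Reasoning
    entryByDecision : (t∈? : Dec (Any (λ e → VF.toList t ↭ edgeTuple k e) (edges H))) → A t ≡ ℕtoℚ (𝟙 t∈?) ℚ.* q
    entryByDecision (yes t∈) = trans (proj₁ layered t (find t∈)) (sym (ℚP.*-identityˡ q))
    entryByDecision (no t∉) = trans (proj₂ layered t (λ (e , e∈E , t↭e) → t∉ (lose e∈E t↭e))) (sym (ℚP.*-zeroˡ q))

  dY-value : ∀ j → dY k A j ≡ ℕtoℚ (#≤ H (suc (toℕ j)))
  dY-value j = begin
    dY k A j
      ≡⟨ sumTuples-multiples k (n + k) _ (λ t → occurrences (y VF.∷ t)) q (λ t → entry (y VF.∷ t)) ⟩
    ℕtoℚ (∑ᵀ k (n + k) (λ t → occurrences (y VF.∷ t))) ℚ.* q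
      ≡⟨ cong (λ c → ℕtoℚ c ℚ.* q) rowCount ⟩
    ℕtoℚ (#≤ H (suc (toℕ j)) * k !) ℚ.* q
      ≡⟨ ℕtoℚ-*-cancel (#≤ H (suc (toℕ j))) (k !) {{k !≢0}} ⟩
    ℕtoℚ (#≤ H (suc (toℕ j))) ∎
    where
    open ≡-Reasoning
    y : Fin (n + k)
    y = yIdx n j
    Es : List (Subset n)
    Es = edges H
    rowCount : ∑ᵀ k (n + k) (λ t → occurrences (y VF.∷ t)) ≡ #≤ H (suc (toℕ j)) * k !
    rowCount = begin
      ∑ᵀ k (n + k) (λ t → ∑ˡ Es (λ e → 𝟙 ((y ∷ VF.toList t) ↭? edgeTuple k e)))
        ≡⟨ ∑ᵀ-∑ˡ-comm k (n + k) Es (λ t e → 𝟙 ((y ∷ VF.toList t) ↭? edgeTuple k e)) ⟩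
      ∑ˡ Es (λ e → ∑ᵀ k (n + k) (λ t → 𝟙 ((y ∷ VF.toList t) ↭? edgeTuple k e)))
        ≡⟨ ∑ˡ-cong Es (λ {e} e∈E → arrangementsFrom k (edgeTuple-unique k e)
             (edgeTuple-length k e (edge-size≥1 H e∈E) (edge-size≤ e∈E)) y (y ∈ˡ? edgeTuple k e)) ⟩
      ∑ˡ Es (λ e → 𝟙 (y ∈ˡ? edgeTuple k e) * k !)
        ≡⟨ ∑ˡ-cong Es (λ {e} _ → cong (_* k !) (𝟙-cong (y ∈ˡ? edgeTuple k e) (∣ e ∣ ≤? suc (toℕ j)) (yIdx∈edgeTuple⇔ k j))) ⟩
      ∑ˡ Es (λ e → 𝟙 (∣ e ∣ ≤? suc (toℕ j)) * k !)
        ≡⟨ ∑ˡ-*-distribʳ Es (λ e → 𝟙 (∣ e ∣ ≤? suc (toℕ j))) (k !) ⟨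
      ∑ˡ Es (λ e → 𝟙 (∣ e ∣ ≤? suc (toℕ j))) * k !
        ≡⟨ cong (_* k !) (length-filter (λ e → ∣ e ∣ ≤? suc (toℕ j)) Es) ⟨
      #≤ H (suc (toℕ j)) * k ! ∎

  -- d_{n+i} counts the hyperedges of size ≤ i, for every 1 ≤ i (for i > k
  -- it is |E|, which counts all hyperedges since they have size ≤ k + 1).
  d-value : ∀ i → 1 ≤ i → d H k A i ≡ ℕtoℚ (#≤ H i)
  d-value i 1≤i with i ∸ 1 <? k
  ... | yes i∸1<k = trans (dY-value (fromℕ< i∸1<k))
    (cong (λ i′ → ℕtoℚ (#≤ H i′)) (trans (cong suc (FP.toℕ-fromℕ< i∸1<k)) (ℕP.m+[n∸m]≡n 1≤i)))
  ... | no i∸1≮k = cong ℕtoℚ (sym (#≤-all H i (λ e∈E → ℕP.≤-trans (edge-size≤ e∈E) k+1≤i)))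
    where
    k+1≤i : suc k ≤ i
    k+1≤i = ℕP.≤-trans (s≤s (ℕP.≮⇒≥ i∸1≮k)) (ℕP.≤-reflexive (ℕP.m+[n∸m]≡n 1≤i))

mainTheorem4 : ∀ {n} (H : Hypergraph n) (k : ℕ) → kmax H ≡ suc k →
    (A : Tensor (suc k) (n + k)) → IsLayeredEAdjacency H k A →
    (∀ i → 1 ≤ i → i ≤ k → d H k A i ≡ ℕtoℚ (countEdges H (λ s → s ≤ i) (λ s → s ≤? i)))
    × (ℕtoℚ (countEdges H (λ s → s ≡ 1) (λ s → s ≟ 1)) ≡ d H k A 1)
    × (∀ j → 2 ≤ j → j ≤ suc k →
         ℕtoℚ (countEdges H (λ s → s ≡ j) (λ s → s ≟ j)) ≡ d H k A j - d H k A (j ∸ 1))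
mainTheorem4 H k kmax≡k+1 A layered =
  (λ i 1≤i _ → d-value′ i 1≤i) , sizeOne , sizeAtLeastTwo
  where
  d-value′ : ∀ i → 1 ≤ i → d H k A i ≡ ℕtoℚ (#≤ H i)
  d-value′ = d-value H k kmax≡k+1 A layered

  sizeOne : ℕtoℚ (#≡ H 1) ≡ d H k A 1
  sizeOne = trans (cong ℕtoℚ (#≡1 H)) (sym (d-value′ 1 ℕP.≤-refl))

  sizeAtLeastTwo : ∀ j → 2 ≤ j → j ≤ suc k → ℕtoℚ (#≡ H j) ≡ d H k A j - d H k A (j ∸ 1)
  sizeAtLeastTwo (suc (suc j)) (s≤s (s≤s z≤n)) _ = difference (begin
    ℕtoℚ (#≡ H (2 + j)) ℚ.+ d H k A (1 + j)         ≡⟨ cong (ℕtoℚ (#≡ H (2 + j)) ℚ.+_) (d-value′ (1 + j) (s≤s z≤n)) ⟩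
    ℕtoℚ (#≡ H (2 + j)) ℚ.+ ℕtoℚ (#≤ H (1 + j))     ≡⟨ ℕtoℚ-+ (#≡ H (2 + j)) (#≤ H (1 + j)) ⟨
    ℕtoℚ (#≡ H (2 + j) + #≤ H (1 + j))             ≡⟨ cong ℕtoℚ (#≤-suc H (1 + j)) ⟨
    ℕtoℚ (#≤ H (2 + j))                            ≡⟨ d-value′ (2 + j) (s≤s z≤n) ⟨
    d H k A (2 + j)                                ∎)
    where open ≡-Reasoning
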